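{- Let $F$ be a frieze pattern of width $w\geqslant 0$ with real entries. Then the entries $e_{1,j}$, $j\in\mathbb{Z}$, of the first row of $F$ are not all $\geqslant 2$.
   Context: A frieze pattern of width $w\geqslant 0$ is an array of real numbers $e_{r,j}$, indexed by rows $r\in\{ -1,0,1,\dots,w+2\}$ and $j\in\mathbb{Z}$, where the entry $e_{r,j}$ is drawn at horizontal position $j+r/2$ (so consecutive rows are shifted by half a step), such that: $e_{ -1,j}=0$ and $e_{0,j}=1$ for all $j$ (the top row of zeros and the row of units numbered $0$); $e_{w+1,j}=1$ and $e_{w+2,j}=0$ for all $j$ (the bottom row of units and row of zeros); and every diamond of four adjacent entries $\begin{smallmatrix}&a&\\ b&&c\\ &d&\end{smallmatrix}$ satisfies $bc-ad=1$, i.e. $e_{r,j}e_{r,j+1}-e_{r-1,j+1}e_{r+1,j}=1$ for all $0\leqslant r\leqslant w+1$ and $j\in\mathbb{Z}$. The width is the number of rows strictly between the two rows of units; the row numbered $1$ is the "first row" (for $w=0$ it is the lower row of units). -}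

module Defs where

open import Level using (0ℓ)
open import Data.Nat as ℕ using (ℕ)
import Data.Nat
open import Data.Integer as ℤ using (ℤ; +_; -[1+_])
open import Data.Product using (Σ; ∃; _×_)
open import Relation.Nullary using (¬_)
open import Relation.Binary.PropositionalEquality using (_≡_)
open import Relation.Binary.Structures using (IsTotalOrder)
open import Algebra.Structures using (IsCommutativeRing)

-- Axiomatic real numbers: a complete (Dedekind / least-upper-bound) ordered field.
-- Any model is isomorphic to ℝ; the theorem is stated for every model.
record RealNumbers : Set₁ where
  infixl 6 _+_ _-_
  infixl 7 _*_
  infix  4 _≤_
  field
    ℝ     : Set
    0ℝ 1ℝ : ℝ
    _+_ _*_ : ℝ → ℝ → ℝ
    -_    : ℝ → ℝ
    _≤_   : ℝ → ℝ → Set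
    isCommutativeRing : IsCommutativeRing _≡_ _+_ _*_ -_ 0ℝ 1ℝ
    0≢1   : ¬ (0ℝ ≡ 1ℝ)
    inverse : ∀ x → ¬ (x ≡ 0ℝ) → Σ ℝ (λ y → x * y ≡ 1ℝ)
    isTotalOrder : IsTotalOrder _≡_ _≤_
    +-mono-≤ : ∀ x y z → x ≤ y → x + z ≤ y + z
    *-nonneg : ∀ x y → 0ℝ ≤ x → 0ℝ ≤ y → 0ℝ ≤ x * y
    complete : (P : ℝ → Set) → Σ ℝ P → Σ ℝ (λ b → ∀ x → P x → x ≤ b) →
               Σ ℝ (λ s → (∀ x → P x → x ≤ s) × (∀ b → (∀ x → P x → x ≤ b) → s ≤ b))

  _-_ : ℝ → ℝ → ℝ
  x - y = x + (- y)

  2ℝ : ℝ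
  2ℝ = 1ℝ + 1ℝ

module _ (Rs : RealNumbers) where
  open RealNumbers Rs

  -- A frieze pattern of width w: entries e r j, r the row index (only rows
  -- -1 … w+2 are meaningful), j ∈ ℤ; entry e r j sits at position j + r/2.
  record IsFrieze (w : ℕ) (e : ℤ → ℤ → ℝ) : Set where
    field
      row-1    : ∀ j → e (ℤ.- (+ 1)) j ≡ 0ℝ
      row0     : ∀ j → e (+ 0) j ≡ 1ℝ
      rowW+1   : ∀ j → e (+ (ℕ.suc w)) j ≡ 1ℝ
      rowW+2   : ∀ j → e (+ (ℕ.suc (ℕ.suc w))) j ≡ 0ℝ
      diamond  : ∀ (r : ℕ) → r Data.Nat.≤ ℕ.suc w → ∀ j →
                 e (+ r) j * e (+ r) (j ℤ.+ + 1)
                   - e (+ r ℤ.- + 1) (j ℤ.+ + 1) * e (+ r ℤ.+ + 1) j ≡ 1ℝ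

{-# OPTIONS --safe #-}
-- If the first row is ≥ 2, induction down the rows shows that every entry
-- exceeds both of its upper neighbours by at least 1: with b on top, x and y
-- beside and c below, x y - b c = 1 together with b ≥ 1 and x, y ≥ b + 1 gives
-- c b = x y - 1 ≥ x (b + 1) - 1 ≥ (x + 1) b, so c ≥ x + 1 and likewise
-- c ≥ y + 1. The row of units numbered w + 1 would then exceed row w, whose
-- entries are ≥ 1, by 1, which is absurd.
module Submission where

open import Defs
open import Data.Nat using (ℕ; zero; suc)
open import Data.Integer using (ℤ; +_)
open import Relation.Nullary using (¬_)

import Data.Nat as ℕ
import Data.Nat.Properties as ℕ
import Data.Integer as ℤ
open import Data.Sum using (inj₁; inj₂)
open import Data.Product using (proj₁; proj₂)
open import Algebra.Bundles using (CommutativeRing)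
import Algebra.Properties.Group as GroupProperties
import Algebra.Properties.Ring as RingProperties
import Algebra.Solver.Ring.NaturalCoefficients.Default as SemiringSolver
open import Relation.Binary.Bundles using (Poset)
open import Relation.Binary.Structures using (IsTotalOrder)
import Relation.Binary.Reasoning.PartialOrder as PosetReasoning
open import Relation.Binary.PropositionalEquality
  using (_≡_; _≢_; refl; sym; trans; cong; subst)

module OrderedFieldLemmas (Rs : RealNumbers) where
  open RealNumbers Rs

  commutativeRing : CommutativeRing _ _
  commutativeRing = record { isCommutativeRing = isCommutativeRing }

  open CommutativeRing commutativeRing
    using (+-comm; +-identityˡ; +-identityʳ; -‿inverseʳ; *-comm; *-assoc; *-identityʳ;
           +-group; ring; commutativeSemiring)
  open GroupProperties +-group using (//-rightDividesˡ; //-rightDividesʳ)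
  open RingProperties ring using (-1*x≈-x; -‿involutive; [y-z]x≈yx-zx)
  open SemiringSolver commutativeSemiring using (solve; _:=_; _:+_; _:*_; con)
  open IsTotalOrder isTotalOrder
    using (antisym; total) renaming (trans to ≤-trans; reflexive to ≤-reflexive)

  poset : Poset _ _ _
  poset = record { isPartialOrder = IsTotalOrder.isPartialOrder isTotalOrder }

  module ≤-Reasoning = PosetReasoning poset
  open ≤-Reasoning

  +-monoˡ-≤ : ∀ z {x y} → x ≤ y → x + z ≤ y + z
  +-monoˡ-≤ z {x} {y} = +-mono-≤ x y z

  +-monoʳ-≤ : ∀ z {x y} → x ≤ y → z + x ≤ z + y
  +-monoʳ-≤ z {x} {y} x≤y = begin
    z + x  ≡⟨ +-comm z x ⟩
    x + z  ≤⟨ +-monoˡ-≤ z x≤y ⟩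
    y + z  ≡⟨ +-comm y z ⟩
    z + y  ∎

  +-cancelʳ-≤ : ∀ z {x y} → x + z ≤ y + z → x ≤ y
  +-cancelʳ-≤ z {x} {y} x+z≤y+z = begin
    x          ≡⟨ //-rightDividesʳ z x ⟨
    x + z - z  ≤⟨ +-monoˡ-≤ (- z) x+z≤y+z ⟩
    y + z - z  ≡⟨ //-rightDividesʳ z y ⟩
    y          ∎

  x≤y⇒0≤y-x : ∀ {x y} → x ≤ y → 0ℝ ≤ y - x
  x≤y⇒0≤y-x {x} {y} x≤y = begin
    0ℝ     ≡⟨ -‿inverseʳ x ⟨
    x - x  ≤⟨ +-monoˡ-≤ (- x) x≤y ⟩
    y - x  ∎

  0≤y-x⇒x≤y : ∀ {x y} → 0ℝ ≤ y - x → x ≤ y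
  0≤y-x⇒x≤y {x} {y} 0≤y-x = begin
    x           ≡⟨ +-identityˡ x ⟨
    0ℝ + x      ≤⟨ +-monoˡ-≤ x 0≤y-x ⟩
    (y - x) + x ≡⟨ //-rightDividesˡ x y ⟩
    y           ∎

  0≤1 : 0ℝ ≤ 1ℝ
  0≤1 with total 0ℝ 1ℝ
  ... | inj₁ 0≤1 = 0≤1
  ... | inj₂ 1≤0 = begin
    0ℝ             ≤⟨ *-nonneg (- 1ℝ) (- 1ℝ) 0≤-1 0≤-1 ⟩
    - 1ℝ * - 1ℝ    ≡⟨ -1*x≈-x (- 1ℝ) ⟩
    - (- 1ℝ)       ≡⟨ -‿involutive 1ℝ ⟩
    1ℝ             ∎
    where
    0≤-1 : 0ℝ ≤ - 1ℝ
    0≤-1 = begin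
      0ℝ         ≡⟨ -‿inverseʳ 1ℝ ⟨
      1ℝ - 1ℝ    ≤⟨ +-monoˡ-≤ (- 1ℝ) 1≤0 ⟩
      0ℝ - 1ℝ    ≡⟨ +-identityˡ (- 1ℝ) ⟩
      - 1ℝ       ∎

  1≰0 : ¬ (1ℝ ≤ 0ℝ)
  1≰0 1≤0 = 0≢1 (antisym 0≤1 1≤0)

  x+1≰x : ∀ x → ¬ (x + 1ℝ ≤ x)
  x+1≰x x x+1≤x = 1≰0 (+-cancelʳ-≤ x (begin
    1ℝ + x  ≡⟨ +-comm 1ℝ x ⟩
    x + 1ℝ  ≤⟨ x+1≤x ⟩
    x       ≡⟨ +-identityˡ x ⟨
    0ℝ + x  ∎))

  x≤x+1 : ∀ x → x ≤ x + 1ℝ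
  x≤x+1 x = begin
    x       ≡⟨ +-identityʳ x ⟨
    x + 0ℝ  ≤⟨ +-monoʳ-≤ x 0≤1 ⟩
    x + 1ℝ  ∎

  *-monoʳ-≤-nonNeg : ∀ r {p q} → 0ℝ ≤ r → p ≤ q → p * r ≤ q * r
  *-monoʳ-≤-nonNeg r {p} {q} 0≤r p≤q = 0≤y-x⇒x≤y (begin
    0ℝ               ≤⟨ *-nonneg (q - p) r (x≤y⇒0≤y-x p≤q) 0≤r ⟩
    (q - p) * r      ≡⟨ [y-z]x≈yx-zx r q p ⟩
    q * r - p * r    ∎)

  *-monoˡ-≤-nonNeg : ∀ r {p q} → 0ℝ ≤ r → p ≤ q → r * p ≤ r * q
  *-monoˡ-≤-nonNeg r {p} {q} 0≤r p≤q = begin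
    r * p  ≡⟨ *-comm r p ⟩
    p * r  ≤⟨ *-monoʳ-≤-nonNeg r 0≤r p≤q ⟩
    q * r  ≡⟨ *-comm q r ⟩
    r * q  ∎

  *-cancelʳ-≢0 : ∀ r {p q} → r ≢ 0ℝ → p * r ≡ q * r → p ≡ q
  *-cancelʳ-≢0 r {p} {q} r≢0 pr≡qr = trans (sym (undo p)) (trans (cong (_* r⁻¹) pr≡qr) (undo q))
    where
    r⁻¹ : ℝ
    r⁻¹ = proj₁ (inverse r r≢0)
    undo : ∀ z → z * r * r⁻¹ ≡ z
    undo z = trans (*-assoc z r r⁻¹) (trans (cong (z *_) (proj₂ (inverse r r≢0))) (*-identityʳ z))

  *-cancelʳ-≤-pos : ∀ r {p q} → 0ℝ ≤ r → r ≢ 0ℝ → p * r ≤ q * r → p ≤ q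
  *-cancelʳ-≤-pos r {p} {q} 0≤r r≢0 pr≤qr with total p q
  ... | inj₁ p≤q = p≤q
  ... | inj₂ q≤p = ≤-reflexive (*-cancelʳ-≢0 r r≢0 (antisym pr≤qr (*-monoʳ-≤-nonNeg r 0≤r q≤p)))

  diamond-growth : ∀ {b x y c} → 1ℝ ≤ b → b + 1ℝ ≤ x → b + 1ℝ ≤ y →
                   x * y - b * c ≡ 1ℝ → x + 1ℝ ≤ c
  diamond-growth {b} {x} {y} {c} 1≤b b+1≤x b+1≤y det =
    *-cancelʳ-≤-pos b 0≤b b≢0 (+-cancelʳ-≤ 1ℝ (begin
      (x + 1ℝ) * b + 1ℝ       ≡⟨ solve 2 (λ x b → (x :+ con 1) :* b :+ con 1 := x :* b :+ (b :+ con 1)) refl x b ⟩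
      x * b + (b + 1ℝ)        ≤⟨ +-monoʳ-≤ (x * b) b+1≤x ⟩
      x * b + x               ≡⟨ solve 2 (λ x b → x :* b :+ x := x :* (b :+ con 1)) refl x b ⟩
      x * (b + 1ℝ)            ≤⟨ *-monoˡ-≤-nonNeg x 0≤x b+1≤y ⟩
      x * y                   ≡⟨ //-rightDividesˡ (b * c) (x * y) ⟨
      x * y - b * c + b * c   ≡⟨ cong (_+ b * c) det ⟩
      1ℝ + b * c              ≡⟨ solve 2 (λ b c → con 1 :+ b :* c := c :* b :+ con 1) refl b c ⟩
      c * b + 1ℝ              ∎))
    where
    0≤b : 0ℝ ≤ b
    0≤b = ≤-trans 0≤1 1≤b
    b≢0 : b ≢ 0ℝ
    b≢0 refl = 1≰0 1≤b
    0≤x : 0ℝ ≤ x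
    0≤x = ≤-trans 0≤b (≤-trans (x≤x+1 b) b+1≤x)

module FriezeRows (Rs : RealNumbers) where
  open RealNumbers Rs
  open OrderedFieldLemmas Rs
  open IsTotalOrder isTotalOrder using () renaming (trans to ≤-trans; reflexive to ≤-reflexive)
  open CommutativeRing commutativeRing using (*-comm)

  module _ {w : ℕ} {e : ℤ → ℤ → ℝ} (isFrieze : IsFrieze Rs w e) (firstRow≥2 : ∀ j → 2ℝ ≤ e (+ 1) j) where
    open IsFrieze isFrieze

    -- Entry (k + 1, j) lies below entries (k, j) and (k, j + 1).
    record Grows (k : ℕ) (j : ℤ) : Set where
      field
        1≤entry       : 1ℝ ≤ e (+ k) j
        left+1≤below  : e (+ k) j + 1ℝ ≤ e (+ suc k) j
        right+1≤below : e (+ k) (j ℤ.+ + 1) + 1ℝ ≤ e (+ suc k) j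

    diamond-below : ∀ k → suc k ℕ.≤ suc w → ∀ j →
      e (+ suc k) j * e (+ suc k) (j ℤ.+ + 1) - e (+ k) (j ℤ.+ + 1) * e (+ suc (suc k)) j ≡ 1ℝ
    diamond-below k k<w+1 j =
      subst (λ n → e (+ suc k) j * e (+ suc k) (j ℤ.+ + 1) - e (+ k) (j ℤ.+ + 1) * e (+ n) j ≡ 1ℝ)
            (ℕ.+-comm (suc k) 1) (diamond (suc k) k<w+1 j)

    grows-zero : ∀ j → Grows 0 j
    grows-zero j = record
      { 1≤entry       = ≤-reflexive (sym (row0 j))
      ; left+1≤below  = subst (λ t → t + 1ℝ ≤ _) (sym (row0 j)) (firstRow≥2 j)
      ; right+1≤below = subst (λ t → t + 1ℝ ≤ _) (sym (row0 (j ℤ.+ + 1))) (firstRow≥2 j)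
      }

    grows-suc : ∀ {k} → suc k ℕ.≤ w → (∀ j → Grows k j) → ∀ j → Grows (suc k) j
    grows-suc {k} k<w grows j = record
      { 1≤entry       = ≤-trans Here.1≤entry (≤-trans (x≤x+1 _) Here.left+1≤below)
      ; left+1≤below  = diamond-growth Right.1≤entry Here.right+1≤below Right.left+1≤below det
      ; right+1≤below = diamond-growth Right.1≤entry Right.left+1≤below Here.right+1≤below
                          (trans (cong (_- b * c) (*-comm y x)) det)
      }
      where
      module Here  = Grows (grows j)
      module Right = Grows (grows (j ℤ.+ + 1))
      x y b c : ℝ
      x = e (+ suc k) j
      y = e (+ suc k) (j ℤ.+ + 1)
      b = e (+ k) (j ℤ.+ + 1)
      c = e (+ suc (suc k)) j
      det : x * y - b * c ≡ 1ℝ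
      det = diamond-below k (ℕ.m≤n⇒m≤1+n k<w) j

    grows : ∀ {k} → k ℕ.≤ w → ∀ j → Grows k j
    grows {zero}  _   = grows-zero
    grows {suc k} k<w = grows-suc k<w (grows (ℕ.<⇒≤ k<w))

mainTheorem1 : (Rs : RealNumbers) → let open RealNumbers Rs in
    (w : ℕ) (e : ℤ → ℤ → ℝ) → IsFrieze Rs w e →
    ¬ (∀ (j : ℤ) → 2ℝ ≤ e (+ 1) j)
mainTheorem1 Rs w e isFrieze firstRow≥2 = x+1≰x 1ℝ (begin
    1ℝ + 1ℝ              ≤⟨ +-monoˡ-≤ 1ℝ 1≤entry ⟩
    e (+ w) (+ 0) + 1ℝ   ≤⟨ left+1≤below ⟩
    e (+ suc w) (+ 0)    ≡⟨ rowW+1 (+ 0) ⟩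
    1ℝ                   ∎)
  where
  open RealNumbers Rs
  open OrderedFieldLemmas Rs
  open ≤-Reasoning
  open IsFrieze isFrieze using (rowW+1)
  open FriezeRows Rs using (module Grows; grows)
  open Grows (grows isFrieze firstRow≥2 ℕ.≤-refl (+ 0))
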